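{- Let $\Gamma$ be a framed four-valent graph with $k$ vertices satisfying the source-target condition, and let $f(\Gamma)=\sum x^{k+2-2g}$, where the sum is taken over all atoms with frame $\Gamma$ (checkerboard-coloured cellular embeddings of $\Gamma$ into closed surfaces preserving the opposite half-edge structure) and $g$ denotes the genus of the surface of the atom. If $\deg f(\Gamma)=k$, then $\Gamma$ admits a checkerboard-colourable embedding into the torus.
   Context: A framed four-valent graph is a finite 4-valent graph (loops and multiple edges allowed) in which, at each vertex, the four half-edges are partitioned into two pairs of "opposite" half-edges. It satisfies the source-target condition if its edges can be oriented so that at each vertex the two half-edges of one opposite pair are outgoing and the two of the other pair are incoming. An atom with frame $\Gamma$ is a closed surface $S$ with a cellular embedding of $\Gamma$ (each component of $S\setminus\Gamma$ an open disc) in which at every vertex the two half-edges of each opposite pair are not cyclically adjacent in the local rotation, together with a colouring of the faces black and white such that the faces on the two sides of each edge have different colours; a checkerboard-colourable embedding is the same thing. Under the source-target condition all such surfaces are orientable, and $g$ is their (orientable) genus, so $k+2-2g$ equals the number of faces of the embedding. -}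

module Defs where

open import Data.Nat using (ℕ; zero; suc; _+_; _*_; _≤_; _<_)
open import Data.Nat.Properties using (_≤?_)
open import Data.Fin using (Fin; toℕ) renaming (zero to f0; suc to fs)
open import Data.Fin.Properties using (_≟_)
open import Data.Bool using (Bool; true; false; not)
open import Data.Product using (Σ; ∃; ∃-syntax; _×_; _,_; proj₁; proj₂)
open import Data.List using (List; length; filter; allFin; cartesianProduct)
open import Data.List.Relation.Unary.All using (All; all?)
open import Data.List using (upTo)
open import Relation.Binary.PropositionalEquality using (_≡_; _≢_)
open import Relation.Binary.Construct.Closure.ReflexiveTransitive using (Star)
open import Relation.Nullary using (Dec; ¬_)
open import Function.Definitions using (Injective)

-- The framing is encoded by the slot labels: at every vertex the
-- opposite pairs are {slot 0, slot 2} and {slot 1, slot 3}.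
-- (Every framed 4-valent graph admits such a labelling.)
-- Edges: a fixed-point-free involution on half-edges (loops and
-- multiple edges allowed).

HalfEdge : ℕ → Set
HalfEdge k = Fin k × Fin 4

vtx : ∀ {k} → HalfEdge k → Fin k
vtx = proj₁

opp : Fin 4 → Fin 4
opp f0 = fs (fs f0)
opp (fs f0) = fs (fs (fs f0))
opp (fs (fs f0)) = f0
opp (fs (fs (fs f0))) = fs f0

record FramedGraph (k : ℕ) : Set where
  field
    pair      : HalfEdge k → HalfEdge k
    pair-invol : ∀ h → pair (pair h) ≡ h
    pair-nofix : ∀ h → pair h ≢ h
open FramedGraph public

Adjacent : ∀ {k} → FramedGraph k → Fin k → Fin k → Set
Adjacent Γ u w = ∃[ i ] ∃[ j ] (pair Γ (u , i) ≡ (w , j))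

Connected : ∀ {k} → FramedGraph k → Set
Connected Γ = ∀ u w → Star (Adjacent Γ) u w

-- Source-target condition: an orientation of the edges, recorded as
-- `out h = true` iff half-edge h is outgoing at its vertex, such that
-- every edge has exactly one outgoing end, and at every vertex one
-- opposite pair is outgoing and the other incoming.
SourceTarget : ∀ {k} → FramedGraph k → Set
SourceTarget {k} Γ = Σ (HalfEdge k → Bool) λ out →
    (∀ h → out (pair Γ h) ≢ out h)
  × (∀ v → out (v , f0) ≡ out (v , fs (fs f0))
         × out (v , fs f0) ≡ out (v , fs (fs (fs f0)))
         × out (v , f0) ≢ out (v , fs f0))

iter : ∀ {A : Set} → (A → A) → ℕ → A → A
iter f zero x = x
iter f (suc n) x = f (iter f n x)

-- A cyclic order on the four half-edges at a vertex: a single 4-cycle,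
-- i.e. an injective (hence bijective) map on Fin 4 acting transitively.
IsCyclicOrder : (Fin 4 → Fin 4) → Set
IsCyclicOrder r = Injective _≡_ _≡_ r × (∀ i j → ∃[ n ] (iter r n i ≡ j))

-- Atoms (orientable cellular embeddings given by rotation systems).
-- `rot v` is the local rotation (cyclic order of half-edges) at v;
-- opposite half-edges are not cyclically adjacent.  The faces are the
-- orbits of the face permutation  h ↦ rot (pair h).  A checkerboard
-- colouring is a colour of faces (a function on half-edges constant on
-- face-orbits) such that the two sides of each edge (the faces of the
-- two half-edges h and pair h) have different colours.

facePerm : ∀ {k} → FramedGraph k → (Fin k → Fin 4 → Fin 4) →
           HalfEdge k → HalfEdge k
facePerm Γ rot h with pair Γ h
... | (w , j) = (w , rot w j)

record Atom {k : ℕ} (Γ : FramedGraph k) : Set where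
  field
    rot        : Fin k → Fin 4 → Fin 4
    rot-cyclic : ∀ v → IsCyclicOrder (rot v)
    rot-frame  : ∀ v i → rot v i ≢ opp i
    colour     : HalfEdge k → Bool
    colour-face : ∀ h → colour (facePerm Γ rot h) ≡ colour h
    colour-edge : ∀ h → colour (pair Γ h) ≢ colour h
open Atom public

-- Number of orbits of a map φ on half-edges: the number of half-edges h
-- that are minimal (w.r.t. the index 4·v + i) in their orbit
-- {φⁿ h | n < 4k} (the orbit of a permutation on 4k points is reached
-- within 4k steps).
idx : ∀ {k} → HalfEdge k → ℕ
idx (v , i) = toℕ v * 4 + toℕ i

allHalfEdges : (k : ℕ) → List (HalfEdge k)
allHalfEdges k = cartesianProduct (allFin k) (allFin 4)

isOrbitMin? : ∀ {k} → (φ : HalfEdge k → HalfEdge k) → (h : HalfEdge k) →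
              Dec (All (λ n → idx h ≤ idx (iter φ n h)) (upTo (k * 4)))
isOrbitMin? {k} φ h = all? (λ n → idx h ≤? idx (iter φ n h)) (upTo (k * 4))

numOrbits : ∀ {k} → (HalfEdge k → HalfEdge k) → ℕ
numOrbits {k} φ = length (filter (isOrbitMin? φ) (allHalfEdges k))

numFaces : ∀ {k} {Γ : FramedGraph k} → Atom Γ → ℕ
numFaces {Γ = Γ} a = numOrbits (facePerm Γ (rot a))

HasGenus : ∀ {k} {Γ : FramedGraph k} → Atom Γ → ℕ → Set
HasGenus {k} a g = numFaces a + 2 * g ≡ k + 2

-- The exponent of x contributed by an atom to f(Γ) = Σ x^(k+2-2g).
exponent : ∀ {k} {Γ : FramedGraph k} → Atom Γ → ℕ
exponent = numFaces

-- Since f(Γ) is a sum of monomials x^(exponent a) with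
-- coefficient 1 each (no cancellation), its degree is d iff some atom
-- contributes x^d and no atom contributes a higher power.
DegreeOfF : ∀ {k} → FramedGraph k → ℕ → Set
DegreeOfF Γ d = (∃[ a ] (exponent {Γ = Γ} a ≡ d)) × (∀ a → exponent {Γ = Γ} a ≤ d)

-- Γ admits a checkerboard-colourable embedding into the torus:
-- an atom whose surface has genus 1 (connected since Γ is connected).
EmbedsInTorus : ∀ {k} → FramedGraph k → Set
EmbedsInTorus Γ = ∃[ a ] HasGenus {Γ = Γ} a 1

module Submission where

open import Defs
open import Data.Nat using (ℕ; _+_)
open import Data.Product using (_,_)
open import Relation.Binary.PropositionalEquality using (_≡_; cong)

hasGenus-one : ∀ {k} {Γ : FramedGraph k} (a : Atom Γ) → numFaces a ≡ k → HasGenus a 1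
hasGenus-one a faces≡k = cong (_+ 2) faces≡k

mainTheorem4 : (k : ℕ) (Γ : FramedGraph k) → Connected Γ → SourceTarget Γ →
    DegreeOfF Γ k → EmbedsInTorus Γ
mainTheorem4 k Γ _ _ ((a , exponent≡k) , _) = a , hasGenus-one a exponent≡k
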